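{- $E_3\le\mathbf{PL}$: every $E_3$-learnable family of structures is $\mathbf{PL}$-learnable.
   Context: All structures are countable with domain $\mathbb{N}$, finite relational signature, identified with atomic diagrams in $2^{\mathbb{N}}$ (subspace topology); $\mathcal{S}\restriction_s$ is the finite substructure on $\{0,\dots,s\}$. A family $\mathfrak{K}$ is a countable set of pairwise nonisomorphic countable structures; $\mathrm{LD}(\mathfrak{K})$ = structures isomorphic to a member of $\mathfrak{K}$; $\mathrm{HS}(\mathfrak{K})=\{\ulcorner\mathcal{A}\urcorner:\mathcal{A}\in\mathfrak{K}\}\cup\{?\}$. A learner is an arbitrary function from $\{\mathcal{S}\restriction_s:\mathcal{S}\in\mathrm{LD}(\mathfrak{K})\}$ to $\mathrm{HS}(\mathfrak{K})$. $\mathfrak{K}$ is $\mathbf{PL}$-learnable if some learner $\mathbf{M}$ satisfies: for every $\mathcal{S}\in\mathrm{LD}(\mathfrak{K})$ and $\mathcal{A}\in\mathfrak{K}$, $\{n:\mathbf{M}(\mathcal{S}\restriction_n)=\ulcorner\mathcal{A}\urcorner\}$ is infinite iff $\mathcal{S}\cong\mathcal{A}$. $\mathfrak{K}$ is $E_3$-learnable if there is a continuous $\Gamma:\mathrm{LD}(\mathfrak{K})\to\mathbb{N}^{\mathbb{N}\times\mathbb{N}}$ (product of discrete topologies) with $\mathcal{S}\cong\mathcal{S}'\iff\Gamma(\mathcal{S})\,E_3\,\Gamma(\mathcal{S}')$ for all $\mathcal{S},\mathcal{S}'\in\mathrm{LD}(\mathfrak{K})$, where $p\,E_3\,q$ iff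 for every $m$ the columns $p^{[m]}=p(\langle m,\cdot\rangle)$ and $q^{[m]}$ satisfy $\exists k\,\forall n\ge k\ p^{[m]}(n)=q^{[m]}(n)$ (with $\langle\cdot,\cdot\rangle$ a computable bijective pairing). -}

module Defs where

open import Data.Nat using (ℕ; suc; _≤_)
open import Data.Fin using (Fin; toℕ)
open import Data.Vec using (Vec; map)
open import Data.Vec.Relation.Unary.All using (All)
open import Data.Bool using (Bool)
open import Data.Maybe using (Maybe; just)
open import Data.Product using (Σ; ∃; _×_)
open import Data.Empty using (⊥)
open import Function.Bundles using (_↔_; Inverse)
open import Function.Definitions using (Injective)
open import Relation.Binary.PropositionalEquality using (_≡_)
open import Relation.Nullary using (¬_)

record Signature : Set where
  field
    k  : ℕ
    ar : Fin k → ℕ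
open Signature public

module _ (σ : Signature) where

  -- A countable structure with domain ℕ, given by its atomic diagram:
  -- the truth value of every atomic fact R_r(v).
  Structure : Set
  Structure = (r : Fin (k σ)) → Vec ℕ (ar σ r) → Bool

  FinStr : ℕ → Set
  FinStr s = (r : Fin (k σ)) → Vec (Fin (suc s)) (ar σ r) → Bool

  restrict : Structure → (s : ℕ) → FinStr s
  restrict S s r v = S r (map toℕ v)

  AgreeUpTo : ℕ → Structure → Structure → Set
  AgreeUpTo s S S' =
    (r : Fin (k σ)) (v : Vec ℕ (ar σ r)) → All (_≤ s) v → S r v ≡ S' r v

  _≅_ : Structure → Structure → Set
  S ≅ S' = Σ (ℕ ↔ ℕ) λ f →
    (r : Fin (k σ)) (v : Vec ℕ (ar σ r)) → S r v ≡ S' r (map (Inverse.to f) v)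

  -- A family 𝔎: a countable (injection into ℕ) index set I and structures
  -- A i that are pairwise non-isomorphic.
  record Family : Set₁ where
    field
      I         : Set
      code      : I → ℕ
      code-inj  : Injective _≡_ _≡_ code
      A         : I → Structure
      pairwise-noniso : (i j : I) → A i ≅ A j → i ≡ j

  module _ (𝔎 : Family) where
    open Family 𝔎

    InLD : Structure → Set
    InLD S = Σ I λ i → S ≅ A i

    -- Learners: maps from finite structures to HS(𝔎) = I ∪ {?}
    -- (nothing = '?').
    Learner : Set
    Learner = (s : ℕ) → FinStr s → Maybe I

    InfinitelyMany : (ℕ → Set) → Set
    InfinitelyMany P = (m : ℕ) → ∃ λ n → m ≤ n × P n

    PLLearns : Learner → Set
    PLLearns M = (S : Structure) → InLD S → (i : I) →
      (InfinitelyMany (λ n → M n (restrict S n) ≡ just i) → S ≅ A i)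
      × (S ≅ A i → InfinitelyMany (λ n → M n (restrict S n) ≡ just i))

    PLLearnable : Set
    PLLearnable = Σ Learner PLLearns

    -- Points of ℕ^(ℕ×ℕ), written curried: p m n = p^[m](n).
    Baire² : Set
    Baire² = ℕ → ℕ → ℕ

    _E₃_ : Baire² → Baire² → Set
    p E₃ q = (m : ℕ) → ∃ λ k₀ → (n : ℕ) → k₀ ≤ n → p m n ≡ q m n

    LDMap : Set
    LDMap = (S : Structure) → InLD S → Baire²

    -- Continuity w.r.t. the subspace topology on LD(𝔎) ⊆ 2^ℕ and the product
    -- of discrete topologies on ℕ^(ℕ×ℕ): every output value Γ(S)(m,n) is
    -- determined, on LD(𝔎), by some finite substructure S↾s.
    Continuous : LDMap → Set
    Continuous Γ = (S : Structure) (h : InLD S) (m n : ℕ) → ∃ λ s →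
      (S' : Structure) (h' : InLD S') → AgreeUpTo s S S' →
      Γ S' h' m n ≡ Γ S h m n

    E₃Learnable : Set
    E₃Learnable = Σ LDMap λ Γ → Continuous Γ ×
      ((S S' : Structure) (h : InLD S) (h' : InLD S') →
        (S ≅ S' → Γ S h E₃ Γ S' h') × (Γ S h E₃ Γ S' h' → S ≅ S'))

-- Let Γ reduce isomorphism on LD(𝔎) to E₃, and write q i = Γ(A i). Two
-- distinct members of 𝔎 have images differing infinitely often in some
-- column col(i, j). At stage s the learner only knows the values of Γ(S)
-- forced by S↾s. Say j beats i if, in column col(i, j), some forced value
-- refutes q i at a position beyond every forced refutation of q j, and j
-- leads at level l if it beats every i ≠ j with code below l. The learner
-- outputs the least-coded j that reaches some level for the first time at
-- stage s. If S ≅ A t, the refutations of q t are bounded in each column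
-- (Γ(S) E₃ q t), so t beats every i ≠ t from some stage on and reaches
-- every level; a wrong i is eventually beaten by t, hence reaches only the
-- finitely many levels ≤ code t, each of them for the first time only once.

module Submission where

open import Defs
open import Axiom.ExcludedMiddle using (ExcludedMiddle)
open import Axiom.DoubleNegationElimination using (em⇒dne)
open import Level using (0ℓ)

open import Data.Nat using (ℕ; zero; suc; _≤_; _<_; _⊔_; _≤?_; _≟_; s≤s)
open import Data.Nat.Properties
open import Data.Nat.DivMod using (_mod_; m≤n⇒m%n≡m)
open import Data.Fin using (toℕ)
open import Data.Fin.Properties using (toℕ-fromℕ<)
open import Data.Vec using (Vec; []; _∷_; map)
open import Data.Vec.Properties using (map-id)
open import Data.Vec.Relation.Unary.All using (All; []; _∷_)
import Data.Vec.Relation.Unary.All as All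
open import Data.Maybe using (Maybe; just; nothing)
open import Data.Maybe.Properties using (just-injective)
open import Data.Product using (∃; ∃-syntax; _×_; _,_; proj₁; proj₂)
open import Data.Sum using (_⊎_; inj₁; inj₂; [_,_]′)
open import Data.Empty using (⊥-elim)
open import Function using (_∘_)
open import Function.Construct.Identity using (↔-id)
open import Function.Definitions using (Injective)
open import Relation.Binary.PropositionalEquality
open import Relation.Nullary using (¬_; yes; no)
open import Relation.Unary using (Pred; _⊆_; _≐_)
open import Relation.Unary.Properties using (≐-sym)

Eventually : (ℕ → Set) → Set
Eventually P = ∃[ s₀ ] (∀ s → s₀ ≤ s → P s)

InfinitelyOften : (ℕ → Set) → Set
InfinitelyOften P = ∀ m → ∃[ n ] m ≤ n × P n

module _ {P Q : ℕ → Set} where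

  eventually-mono : (∀ {s} → P s → Q s) → Eventually P → Eventually Q
  eventually-mono P⇒Q (s₀ , p) = s₀ , λ s s₀≤s → P⇒Q (p s s₀≤s)

  eventually-× : Eventually P → Eventually Q → Eventually (λ s → P s × Q s)
  eventually-× (a , p) (b , q) =
    a ⊔ b , λ s a⊔b≤s → p s (≤-trans (m≤m⊔n a b) a⊔b≤s) , q s (≤-trans (m≤n⊔m a b) a⊔b≤s)

infinitelyOften⇒¬eventually¬ : ∀ {P : ℕ → Set} → InfinitelyOften P → ¬ Eventually (¬_ ∘ P)
infinitelyOften⇒¬eventually¬ often (s₀ , never) =
  let n , s₀≤n , pn = often s₀ in never n s₀≤n pn

eventually-∀< : ∀ {P : ℕ → ℕ → Set} l → (∀ k → k < l → Eventually (P k)) →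
  Eventually (λ s → ∀ k → k < l → P k s)
eventually-∀< zero    _  = 0 , λ _ _ _ ()
eventually-∀< {P} (suc l) ev =
  eventually-mono combine (eventually-× (eventually-∀< l (λ k k<l → ev k (m<n⇒m<1+n k<l))) (ev l ≤-refl))
  where
  combine : ∀ {s} → (∀ k → k < l → P k s) × P l s → ∀ k → k < suc l → P k s
  combine (below , at) k k<1+l = [ below k , (λ { refl → at }) ]′ (m<1+n⇒m<n∨m≡n k<1+l)

module Classical (lem : ExcludedMiddle 0ℓ) where

  first-below : ∀ {P : ℕ → Set} a →
    (∃[ m ] P m × (∀ k → k < m → ¬ P k)) ⊎ (∀ k → k < a → ¬ P k)
  first-below zero = inj₂ λ _ ()
  first-below {P} (suc a) with first-below {P} a | lem {P a}
  ... | inj₁ found | _      = inj₁ found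
  ... | inj₂ none  | yes pa = inj₁ (a , pa , none)
  ... | inj₂ none  | no ¬pa = inj₂ λ k k<1+a → [ none k , (λ { refl → ¬pa }) ]′ (m<1+n⇒m<n∨m≡n k<1+a)

  minimal-witness : ∀ {P : ℕ → Set} → ∃ P → ∃[ m ] P m × (∀ k → k < m → ¬ P k)
  minimal-witness {P} (n , pn) with first-below {P} (suc n)
  ... | inj₁ found = found
  ... | inj₂ none  = ⊥-elim (none n ≤-refl pn)

  eventually-hasEarlier : (P : ℕ → Set) → Eventually (λ s → P s → ∃[ s' ] s' < s × P s')
  eventually-hasEarlier P with lem {∃ P}
  ... | yes (s' , ps') = suc s' , λ _ s'<s _ → s' , s'<s , ps'
  ... | no ¬∃P         = 0 , λ s _ ps → ⊥-elim (¬∃P (s , ps))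

  ¬∀⇒∃¬ : ∀ {P : ℕ → Set} → ¬ (∀ m → P m) → ∃[ m ] ¬ P m
  ¬∀⇒∃¬ {P} ¬∀P = em⇒dne lem λ ¬∃¬P → ¬∀P λ m → em⇒dne lem λ ¬pm → ¬∃¬P (m , ¬pm)

  ¬eventuallyEqual⇒infinitelyOftenDistinct : ∀ {f g : ℕ → ℕ} →
    ¬ Eventually (λ n → f n ≡ g n) → InfinitelyOften (λ n → f n ≢ g n)
  ¬eventuallyEqual⇒infinitelyOftenDistinct {f} {g} ¬eq N with lem {∃[ n ] N ≤ n × f n ≢ g n}
  ... | yes found = found
  ... | no none   = ⊥-elim (¬eq (N , equal))
    where
    equal : ∀ n → N ≤ n → f n ≡ g n
    equal n N≤n with f n ≟ g n
    ... | yes f≡g = f≡g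
    ... | no  f≢g = ⊥-elim (none (n , N≤n , f≢g))

  witness : (P : ℕ → Set) → ℕ
  witness P with lem {∃ P}
  ... | yes (m , _) = m
  ... | no _        = 0

  witness-correct : ∀ {P : ℕ → Set} → ∃ P → P (witness P)
  witness-correct {P} ∃P with lem {∃ P}
  ... | yes (_ , pm) = pm
  ... | no ¬∃P       = ⊥-elim (¬∃P ∃P)

  module Coded {I : Set} (code : I → ℕ) (code-inj : Injective _≡_ _≡_ code) where

    IsLeast : Pred I 0ℓ → Pred I 0ℓ
    IsLeast P j = P j × (∀ i → P i → code j ≤ code i)

    leastCoded : Pred I 0ℓ → Maybe I
    leastCoded P with lem {∃ (IsLeast P)}
    ... | yes (j , _) = just j
    ... | no _        = nothing

    leastCoded-sound : ∀ {P j} → leastCoded P ≡ just j → P j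
    leastCoded-sound {P} chosen with lem {∃ (IsLeast P)}
    ... | yes (_ , pj , _) = subst P (just-injective chosen) pj
    leastCoded-sound () | no _

    leastCoded-complete : ∀ {P j} → IsLeast P j → leastCoded P ≡ just j
    leastCoded-complete {P} {j} (pj , j-least) with lem {∃ (IsLeast P)}
    ... | yes (j' , pj' , j'-least) = cong just (code-inj (≤-antisym (j'-least j pj) (j-least j' pj')))
    ... | no none = ⊥-elim (none (j , pj , j-least))

    isLeast-resp : ∀ {P Q} → P ≐ Q → IsLeast P ⊆ IsLeast Q
    isLeast-resp (P⊆Q , Q⊆P) (pj , j-least) = P⊆Q pj , λ i qi → j-least i (Q⊆P qi)

    leastCoded-resp : ∀ {P Q} → P ≐ Q → leastCoded P ≡ leastCoded Q
    leastCoded-resp {P} {Q} P≐Q with lem {∃ (IsLeast P)} | lem {∃ (IsLeast Q)}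
    ... | yes (j , lj) | yes (j' , lj') =
      cong just (code-inj (≤-antisym (proj₂ lj j' (proj₂ P≐Q (proj₁ lj')))
                                     (proj₂ lj' j (proj₁ P≐Q (proj₁ lj)))))
    ... | yes (j , lj) | no none = ⊥-elim (none (j , isLeast-resp P≐Q lj))
    ... | no none | yes (j' , lj') = ⊥-elim (none (j' , isLeast-resp (≐-sym P≐Q) lj'))
    ... | no _ | no _ = refl

    eventually-∀code< : ∀ {D : Pred I 0ℓ} {Q : I → ℕ → Set} → (∀ i → D i → Eventually (Q i)) →
      ∀ l → Eventually (λ s → ∀ i → code i < l → D i → Q i s)
    eventually-∀code< {D} {Q} ev l =
      eventually-mono (λ all i ci<l di → all (code i) ci<l i refl di) (eventually-∀< l atCode)
      where
      atCode : ∀ k → k < l → Eventually (λ s → ∀ i → code i ≡ k → D i → Q i s)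
      atCode k _ with lem {∃[ i ] code i ≡ k × D i}
      ... | yes (i , refl , di) =
        eventually-mono (λ qi i' ci'≡ci _ → subst (λ z → Q z _) (sym (code-inj ci'≡ci)) qi) (ev i di)
      ... | no none = 0 , λ _ _ i ci≡k di → ⊥-elim (none (i , ci≡k , di))

-- Φ (m , n , x): the value at position n of column m is known to be x.
Forcing : Set₁
Forcing = Pred (ℕ × ℕ × ℕ) 0ℓ

module Strategy (lem : ExcludedMiddle 0ℓ) {I : Set} (code : I → ℕ) (code-inj : Injective _≡_ _≡_ code)
  (q : I → ℕ → ℕ → ℕ) (col : I → I → ℕ)
  (col-separates : ∀ {i j} → i ≢ j → InfinitelyOften (λ n → q i (col i j) n ≢ q j (col i j) n)) where

  open Classical lem
  open Coded code code-inj

  Refutes : Forcing → I → ℕ → ℕ → Set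
  Refutes Φ i m n = ∃[ x ] Φ (m , n , x) × x ≢ q i m n

  Beats : Forcing → I → I → Set
  Beats Φ j i = ∃[ n ] Refutes Φ i (col i j) n × (∀ n' → Refutes Φ j (col i j) n' → n' < n)

  Leads : ℕ → Forcing → I → ℕ → Set
  Leads s Φ j l = l ≤ s × (∀ i → code i < l → i ≢ j → Beats Φ j i)

  Fresh : ℕ → (ℕ → Forcing) → I → Set
  Fresh s Φ j = ∃[ l ] Leads s (Φ s) j l × (∀ s' → s' < s → ¬ Leads s' (Φ s') j l)

  choice : ℕ → (ℕ → Forcing) → Maybe I
  choice s Φ = leastCoded (Fresh s Φ)

  refutes-mono : ∀ {Φ Ψ i m n} → Φ ⊆ Ψ → Refutes Φ i m n → Refutes Ψ i m n
  refutes-mono Φ⊆Ψ (x , φ , x≢) = x , Φ⊆Ψ φ , x≢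

  beats-resp : ∀ {Φ Ψ j i} → Φ ≐ Ψ → Beats Φ j i → Beats Ψ j i
  beats-resp {Φ} {Ψ} (Φ⊆Ψ , Ψ⊆Φ) (n , refuted , later) =
    n , refutes-mono {Φ} Φ⊆Ψ refuted , λ n' r → later n' (refutes-mono {Ψ} Ψ⊆Φ r)

  leads-resp : ∀ {Φ Ψ s j l} → Φ ≐ Ψ → Leads s Φ j l → Leads s Ψ j l
  leads-resp Φ≐Ψ (l≤s , beats) = l≤s , λ i ci<l i≢j → beats-resp Φ≐Ψ (beats i ci<l i≢j)

  fresh-resp : ∀ {Φ Ψ s} → (∀ s' → s' ≤ s → Φ s' ≐ Ψ s') → Fresh s Φ ⊆ Fresh s Ψ
  fresh-resp Φ≐Ψ (l , leads , first) =
    l , leads-resp (Φ≐Ψ _ ≤-refl) leads ,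
    λ s' s'<s leads' → first s' s'<s (leads-resp (≐-sym (Φ≐Ψ s' (<⇒≤ s'<s))) leads')

  choice-resp : ∀ {Φ Ψ s} → (∀ s' → s' ≤ s → Φ s' ≐ Ψ s') → choice s Φ ≡ choice s Ψ
  choice-resp Φ≐Ψ = leastCoded-resp (fresh-resp Φ≐Ψ , fresh-resp (λ s' s'≤s → ≐-sym (Φ≐Ψ s' s'≤s)))

  module Correctness (p : ℕ → ℕ → ℕ) (Φ : ℕ → Forcing)
    (sound : ∀ {s m n x} → Φ s (m , n , x) → x ≡ p m n)
    (complete : ∀ m n → Eventually (λ s → Φ s (m , n , p m n)))
    (t : I) (p≈t : ∀ m → Eventually (λ n → p m n ≡ q t m n)) where

    agreesFrom : ℕ → ℕ
    agreesFrom m = proj₁ (p≈t m)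

    agrees : ∀ {m n} → agreesFrom m ≤ n → p m n ≡ q t m n
    agrees {m} {n} = proj₂ (p≈t m) n

    refutations-of-t-bounded : ∀ {s m n} → Refutes (Φ s) t m n → n < agreesFrom m
    refutations-of-t-bounded {m = m} {n} (x , φ , x≢) with agreesFrom m ≤? n
    ... | yes N≤n = ⊥-elim (x≢ (trans (sound φ) (agrees N≤n)))
    ... | no  N≰n = ≰⇒> N≰n

    eventually-refutes : ∀ i {m n} → agreesFrom m ≤ n → q t m n ≢ q i m n →
      Eventually (λ s → Refutes (Φ s) i m n)
    eventually-refutes i {m} {n} N≤n differ =
      eventually-mono (λ φ → p m n , φ , differ ∘ trans (sym (agrees N≤n))) (complete m n)

    eventually-beats : ∀ i → i ≢ t → Eventually (λ s → Beats (Φ s) t i)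
    eventually-beats i i≢t with col-separates i≢t (agreesFrom (col i t))
    ... | n , N≤n , differ =
      eventually-mono (λ refuted → n , refuted , λ n' r → <-≤-trans (refutations-of-t-bounded r) N≤n)
                      (eventually-refutes i N≤n (≢-sym differ))

    eventually-unbeaten : ∀ i → i ≢ t → Eventually (λ s → ¬ Beats (Φ s) i t)
    eventually-unbeaten i i≢t with col-separates (≢-sym i≢t) (agreesFrom (col t i))
    ... | n , N≤n , differ =
      eventually-mono (λ refuted (n' , r' , beyond) →
                         <-irrefl refl (<-trans (beyond n refuted) (<-≤-trans (refutations-of-t-bounded r') N≤n)))
                      (eventually-refutes i N≤n differ)

    eventually-leads : ∀ l → Eventually (λ s → Leads s (Φ s) t l)
    eventually-leads l = eventually-× (l , λ _ l≤s → l≤s) (eventually-∀code< eventually-beats l)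

    eventually-not-fresh : ∀ i → i ≢ t → Eventually (λ s → ¬ Fresh s Φ i)
    eventually-not-fresh i i≢t =
      eventually-mono notFresh
        (eventually-× (eventually-unbeaten i i≢t)
                      (eventually-∀< (suc (code t)) λ l _ → eventually-hasEarlier (λ s → Leads s (Φ s) i l)))
      where
      notFresh : ∀ {s} → ¬ Beats (Φ s) i t ×
        (∀ l → l < suc (code t) → Leads s (Φ s) i l → ∃[ s' ] s' < s × Leads s' (Φ s') i l) →
        ¬ Fresh s Φ i
      notFresh (unbeaten , recurs) (l , leads , first) with l ≤? code t
      ... | yes l≤t = let s' , s'<s , leads' = recurs l (s≤s l≤t) leads in first s' s'<s leads'
      ... | no  l≰t = unbeaten (proj₂ leads t (≰⇒> l≰t) (≢-sym i≢t))

    -- The level m ⊔ B is first reached at a stage beyond m ⊔ B, where no i with code below t is fresh.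
    chosen-infinitely-often : InfinitelyOften (λ s → choice s Φ ≡ just t)
    chosen-infinitely-often m with eventually-∀code< eventually-not-fresh (code t)
    ... | B , noSmallerFresh
        with minimal-witness {λ s → Leads s (Φ s) t (m ⊔ B)} (_ , proj₂ (eventually-leads (m ⊔ B)) _ ≤-refl)
    ... | s , leads , first =
      s , ≤-trans (m≤m⊔n m B) (proj₁ leads) , leastCoded-complete ((m ⊔ B , leads , first) , t-least)
      where
      t-least : ∀ i → Fresh s Φ i → code t ≤ code i
      t-least i fresh with code t ≤? code i
      ... | yes ct≤ci = ct≤ci
      ... | no  ct≰ci = ⊥-elim (noSmallerFresh s (≤-trans (m≤n⊔m m B) (proj₁ leads)) i (≰⇒> ct≰ci)
                                   (λ i≡t → <-irrefl (cong code i≡t) (≰⇒> ct≰ci)) fresh)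

    eventually-not-chosen : ∀ i → i ≢ t → Eventually (λ s → choice s Φ ≢ just i)
    eventually-not-chosen i i≢t =
      eventually-mono (λ ¬fresh chosen → ¬fresh (leastCoded-sound chosen)) (eventually-not-fresh i i≢t)

toℕ-mod : ∀ {x s} → x ≤ s → toℕ (x mod suc s) ≡ x
toℕ-mod x≤s = trans (toℕ-fromℕ< _) (m≤n⇒m%n≡m x≤s)

toℕ∘mod-fixes : ∀ {s n} (v : Vec ℕ n) → All (_≤ s) v → map toℕ (map (_mod suc s) v) ≡ v
toℕ∘mod-fixes []      []          = refl
toℕ∘mod-fixes (x ∷ v) (x≤s ∷ v≤s) = cong₂ _∷_ (toℕ-mod x≤s) (toℕ∘mod-fixes v v≤s)

module _ {σ : Signature} where

  ≅-refl : (S : Structure σ) → _≅_ σ S S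
  ≅-refl S = ↔-id ℕ , λ r v → cong (S r) (sym (map-id v))

  agree-sym : ∀ {s S T} → AgreeUpTo σ s S T → AgreeUpTo σ s T S
  agree-sym S~T r v v≤s = sym (S~T r v v≤s)

  agree-trans : ∀ {s S T U} → AgreeUpTo σ s S T → AgreeUpTo σ s T U → AgreeUpTo σ s S U
  agree-trans S~T T~U r v v≤s = trans (S~T r v v≤s) (T~U r v v≤s)

  agree-mono : ∀ {s s' S T} → s ≤ s' → AgreeUpTo σ s' S T → AgreeUpTo σ s S T
  agree-mono s≤s' S~T r v v≤s = S~T r v (All.map (λ x≤s → ≤-trans x≤s s≤s') v≤s)

  -- Facts about elements above s are junk (arguments wrap mod s + 1); only AgreeUpTo s is ever used.
  extend : ∀ {s} → FinStr σ s → Structure σ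
  extend {s} F r v = F r (map (_mod suc s) v)

  extend-restrict : ∀ S s → AgreeUpTo σ s S (extend (restrict σ S s))
  extend-restrict S s r v v≤s = cong (S r) (sym (toℕ∘mod-fixes v v≤s))

module FromE₃ (lem : ExcludedMiddle 0ℓ) (σ : Signature) (𝔎 : Family σ) (e₃ : E₃Learnable σ 𝔎) where

  open Family 𝔎
  open Classical lem

  Γ : LDMap σ 𝔎
  Γ = proj₁ e₃

  Γ-continuous : Continuous σ 𝔎 Γ
  Γ-continuous = proj₁ (proj₂ e₃)

  ≅⇒E₃ : ∀ {S S'} (h : InLD σ 𝔎 S) (h' : InLD σ 𝔎 S') → _≅_ σ S S' → _E₃_ σ 𝔎 (Γ S h) (Γ S' h')
  ≅⇒E₃ h h' = proj₁ (proj₂ (proj₂ e₃) _ _ h h')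

  E₃⇒≅ : ∀ {S S'} (h : InLD σ 𝔎 S) (h' : InLD σ 𝔎 S') → _E₃_ σ 𝔎 (Γ S h) (Γ S' h') → _≅_ σ S S'
  E₃⇒≅ h h' = proj₂ (proj₂ (proj₂ e₃) _ _ h h')

  A∈LD : ∀ i → InLD σ 𝔎 (A i)
  A∈LD i = i , ≅-refl (A i)

  q : I → ℕ → ℕ → ℕ
  q i = Γ (A i) (A∈LD i)

  Separates : I → I → ℕ → Set
  Separates i j m = InfinitelyOften (λ n → q i m n ≢ q j m n)

  distinct⇒separated : ∀ {i j} → i ≢ j → ∃ (Separates i j)
  distinct⇒separated {i} {j} i≢j =
    let m , notEventually = ¬∀⇒∃¬ (i≢j ∘ pairwise-noniso i j ∘ E₃⇒≅ (A∈LD i) (A∈LD j))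
    in m , ¬eventuallyEqual⇒infinitelyOftenDistinct notEventually

  col : I → I → ℕ
  col i j = witness (Separates i j)

  open Strategy lem code code-inj q col (witness-correct ∘ distinct⇒separated)

  Forced : ℕ → Structure σ → Forcing
  Forced s S (m , n , x) = ∀ T (T∈LD : InLD σ 𝔎 T) → AgreeUpTo σ s S T → Γ T T∈LD m n ≡ x

  forced-resp : ∀ {s S T} → AgreeUpTo σ s S T → Forced s S ≐ Forced s T
  forced-resp S~T = (λ φ U hU T~U → φ U hU (agree-trans S~T T~U))
                  , (λ φ U hU S~U → φ U hU (agree-trans (agree-sym S~T) S~U))

  forced-sound : ∀ {S} (h : InLD σ 𝔎 S) {s m n x} → Forced s S (m , n , x) → x ≡ Γ S h m n
  forced-sound h φ = sym (φ _ h (λ _ _ _ → refl))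

  forced-complete : ∀ {S} (h : InLD σ 𝔎 S) m n → Eventually (λ s → Forced s S (m , n , Γ S h m n))
  forced-complete h m n =
    let s₀ , determined = Γ-continuous _ h m n
    in s₀ , λ s s₀≤s T hT S~T → determined T hT (agree-mono s₀≤s S~T)

  learner : Learner σ 𝔎
  learner s F = choice s (λ s' → Forced s' (extend F))

  learner-on-restriction : ∀ S s → learner s (restrict σ S s) ≡ choice s (λ s' → Forced s' S)
  learner-on-restriction S s =
    choice-resp λ s' s'≤s → forced-resp (agree-mono s'≤s (agree-sym (extend-restrict S s)))

  module _ {S} (h : InLD σ 𝔎 S) (t : I) (S≅t : _≅_ σ S (A t)) where
    open Correctness (Γ S h) (λ s → Forced s S) (forced-sound h) (forced-complete h) t (≅⇒E₃ h (A∈LD t) S≅t)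

    learner-outputs-infinitely-often : InfinitelyOften (λ s → learner s (restrict σ S s) ≡ just t)
    learner-outputs-infinitely-often m =
      let s , m≤s , chosen = chosen-infinitely-often m in s , m≤s , trans (learner-on-restriction S s) chosen

    learner-eventually-avoids : ∀ i → i ≢ t → Eventually (λ s → learner s (restrict σ S s) ≢ just i)
    learner-eventually-avoids i i≢t =
      eventually-mono (λ {s} avoids → avoids ∘ trans (sym (learner-on-restriction S s))) (eventually-not-chosen i i≢t)

  learns : PLLearns σ 𝔎 learner
  learns S h@(t , S≅t) i = onlyCorrect , learner-outputs-infinitely-often h i
    where
    onlyCorrect : InfinitelyOften (λ s → learner s (restrict σ S s) ≡ just i) → _≅_ σ S (A i)
    onlyCorrect often with lem {i ≡ t}
    ... | yes refl = S≅t
    ... | no  i≢t  = ⊥-elim (infinitelyOften⇒¬eventually¬ often (learner-eventually-avoids h t S≅t i i≢t))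

mainTheorem15 : ExcludedMiddle 0ℓ → (σ : Signature) (𝔎 : Family σ) →
    E₃Learnable σ 𝔎 → PLLearnable σ 𝔎
mainTheorem15 lem σ 𝔎 e₃ = learner , learns
  where open FromE₃ lem σ 𝔎 e₃
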